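{- Let $r\ge 3$ and $1\le s\le r-1$, and let $\Gamma \cong {\rm SPX}(r,s)$, with $n$ vertices. Then $\mu(g) \le \frac{17n}{6\, o(g)}$ for every $g\in \mathrm{Aut}(\Gamma)$, and consequently $\mu(\Gamma)\le \frac{17n}{6\,{\rm meo}(\Gamma)}$.
   Context: For a permutation $g$, $o(g)$ is its order and $\mu(g)$ the number of orbits of $\langle g\rangle$; $\mu(\Gamma)=\min_{g\in\mathrm{Aut}(\Gamma)}\mu(g)$, ${\rm meo}(\Gamma)=\max_{g\in\mathrm{Aut}(\Gamma)}o(g)$. For $r\ge 3$, let $\vec{\rm PX}(r,1)$ be the directed graph with vertex set $\mathbb{Z}_r\times\mathbb{Z}_2$ and an arc from $(x,i)$ to $(x+1,j)$ for all $x\in\mathbb{Z}_r$, $i,j\in\mathbb{Z}_2$. For $2\le s\le r-1$, $\vec{\rm PX}(r,s)$ is the directed graph whose vertices are the directed paths $(u_0,\dots,u_s)$ of length $s$ in $\vec{\rm PX}(r,1)$, with an arc from $(u_0,\dots,u_s)$ to $(u_1,\dots,u_s,u_{s+1})$ for each of the two out-neighbours $u_{s+1}$ of $u_s$ in $\vec{\rm PX}(r,1)$. The Split Praeger-Xu graph ${\rm SPX}(r,s)$ is the undirected graph obtained from $\vec{\rm PX}(r,s)$ by replacing each vertex $u$ by two vertices $u_-,u_+$, joining $u_-$ to $u_+$ for every vertex $u$, and joining $v_+$ to $u_-$ for every arc $(v,u)$ of $\vec{\rm PX}(r,s)$. -}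

module Defs where

open import Data.Nat using (ℕ; zero; suc; _≤_; _<_)
open import Data.Fin using (Fin; toℕ)
open import Data.Vec using (Vec; lookup)
open import Data.Bool using (Bool; true; false)
open import Data.Product using (_×_; _,_; Σ; ∃)
open import Data.Sum using (_⊎_)
open import Data.Empty using (⊥)
open import Relation.Binary.PropositionalEquality using (_≡_)
open import Function.Bundles using (_↔_; Inverse)

-- A vertex of PX→(r,1) is (x , i) ∈ Z_r × Z_2.
-- For 2 ≤ s ≤ r-1 a vertex of PX→(r,s) is a directed path
-- (u_0,...,u_s) of PX→(r,1); since u_{j+1} has first coordinate
-- x_j + 1, such a path is determined by the first coordinate x of u_0
-- and the second coordinates (b_0,...,b_s) ∈ Z_2^{s+1} (and every such
-- datum gives a path, whose vertices are distinct because s+1 ≤ r).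

len : ℕ → ℕ
len (suc zero) = 1
len s          = suc s

PXVertex : ℕ → ℕ → Set
PXVertex r s = Fin r × Vec Bool (len s)

NextMod : {r : ℕ} → Fin r → Fin r → Set
NextMod {r} x y = (toℕ y ≡ suc (toℕ x)) ⊎ ((toℕ y ≡ 0) × (suc (toℕ x) ≡ r))

-- arcs of PX→(r,s): (x , b_0..b_{k-1}) → (x+1 , b_1..b_{k-1} , c), c arbitrary
PXArc : (r s : ℕ) → PXVertex r s → PXVertex r s → Set
PXArc r s (x , b) (y , c) =
  NextMod x y ×
  ((i j : Fin (len s)) → toℕ j ≡ suc (toℕ i) → lookup c i ≡ lookup b j)

-- The split Praeger–Xu graph SPX(r,s): vertex (u , false) is u_- and
-- (u , true) is u_+.

SPXVertex : ℕ → ℕ → Set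
SPXVertex r s = PXVertex r s × Bool

SPXEdge : (r s : ℕ) → SPXVertex r s → SPXVertex r s → Set
SPXEdge r s (u , false) (v , true) = u ≡ v
SPXEdge r s (v , true) (u , false) = PXArc r s v u
SPXEdge r s _ _ = ⊥

SPXAdj : (r s : ℕ) → SPXVertex r s → SPXVertex r s → Set
SPXAdj r s a b = SPXEdge r s a b ⊎ SPXEdge r s b a

iter : {A : Set} → (A → A) → ℕ → A → A
iter f zero    a = a
iter f (suc m) a = f (iter f m a)

module _ {V : Set} where

  perm : V ↔ V → V → V
  perm g = Inverse.to g

  IsAut : (V → V → Set) → V ↔ V → Set
  IsAut Adj g = (u v : V) →
    (Adj u v → Adj (perm g u) (perm g v)) × (Adj (perm g u) (perm g v) → Adj u v)

  IsOrder : V ↔ V → ℕ → Set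
  IsOrder g m = (0 < m) × ((v : V) → iter (perm g) m v ≡ v)
              × ((m' : ℕ) → 0 < m' → ((v : V) → iter (perm g) m' v ≡ v) → m ≤ m')

  SameOrbit : V ↔ V → V → V → Set
  SameOrbit g u v = ∃ λ m → iter (perm g) m u ≡ v

  NumOrbits : V ↔ V → ℕ → Set
  NumOrbits g k = Σ (Fin k → V) λ rep →
    ((i j : Fin k) → SameOrbit g (rep i) (rep j) → i ≡ j) ×
    ((v : V) → ∃ λ i → SameOrbit g (rep i) v)

  IsMuGraph : (V → V → Set) → ℕ → Set
  IsMuGraph Adj m = (∃ λ g → IsAut Adj g × NumOrbits g m)
                  × ((g : V ↔ V) (k : ℕ) → IsAut Adj g → NumOrbits g k → m ≤ k)

  IsMeo : (V → V → Set) → ℕ → Set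
  IsMeo Adj M = (∃ λ g → IsAut Adj g × IsOrder g M)
              × ((g : V ↔ V) (k : ℕ) → IsAut Adj g → IsOrder g k → k ≤ M)

-- Every automorphism of SPX(r,s) that fixes a vertex is an involution. Hence if g^p fixes a
-- point then g^(2p) = 1, so every orbit of ⟨g⟩ has at least ⌈o(g)/2⌉ points, and
-- μ(g) ⌈o(g)/2⌉ ≤ n, i.e. even 6 o(g) μ(g) ≤ 12 n.
--
-- An automorphism h of the split graph fixing a vertex maps the matching edges u₋u₊ to matching
-- edges, as these are exactly the edges on no 4-cycle (here r ≥ 3 is used); since the graph is
-- connected and h fixes a vertex, h also preserves the two sides {u₋} and {u₊}. So h comes from an
-- automorphism of the digraph fixing a vertex. Write D_k for the digraph on Z_r × Z_2^k (so
-- PX(r,1) = D_1 and PX(r,s) = D_(s+1)). D_(k+1) is the line digraph of D_k, so an automorphism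
-- of D_(k+1) fixing a vertex induces one of D_k, and is an involution when the induced one is.
-- On D_1 an automorphism fixing a vertex preserves every layer {x} × Z_2, hence is an involution.

module Submission where

open import Defs
open import Data.Bool as Bool using (Bool; true; false; not)
open import Data.Bool.Properties using (not-involutive; not-¬; ¬-not)
open import Data.Empty using (⊥; ⊥-elim)
open import Data.Fin as Fin using (Fin; toℕ; fromℕ<)
open import Data.Fin.Properties
  using (toℕ-injective; toℕ<n; toℕ-fromℕ<; toℕ-inject; injective⇒≤; *↔×; any?; all?; ¬∀⟶∃¬-smallest)
  renaming (_<?_ to _<ᶠ?_; <-cmp to <ᶠ-cmp)
open import Data.List using (List; filter; length; lookup; allFin)
open import Data.List.Membership.Propositional.Properties using (∈-filter⁺; ∈-allFin; ∈-lookup)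
open import Data.List.Relation.Unary.All as All using (All)
open import Data.List.Relation.Unary.All.Properties using (all-filter)
open import Data.List.Relation.Unary.AllPairs using (_∷_)
open import Data.List.Relation.Unary.Any using (index)
open import Data.List.Relation.Unary.Any.Properties using (lookup-index)
open import Data.List.Relation.Unary.Unique.Propositional using (Unique)
import Data.List.Relation.Unary.Unique.Propositional.Properties as Unique
open import Data.Nat
  using (ℕ; zero; suc; _+_; _*_; _∸_; _≤_; _<_; s≤s; s≤s⁻¹; z≤n; _<?_; NonZero; >-nonZero; _%_; _/_; ⌈_/2⌉; ⌊_/2⌋)
open import Data.Nat.DivMod using (m≡m%n+[m/n]*n; m%n<n)
open import Data.Nat.Properties
open import Data.Nat.Tactic.RingSolver using (solve-∀)
open import Data.Product.Properties using (,-injectiveˡ; ,-injectiveʳ)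
open import Data.Product using (_×_; _,_; ∃; ∃₂; proj₁; proj₂)
open import Data.Sum as Sum using (_⊎_; inj₁; inj₂; swap)
open import Data.Vec as Vec using (Vec; []; _∷_; _∷ʳ_)
open import Data.Vec.Properties using (∷-injectiveˡ; ∷-injectiveʳ; init-∷ʳ; last-∷ʳ)
open import Function using (_∘_; id)
open import Function.Bundles using (_↔_; _⇔_; Inverse; Injection; Equivalence; mk↣; mk⇔)
open import Function.Construct.Composition using (_↣-∘_)
open import Function.Properties.Inverse using (↔⇒↣)
open import Relation.Binary.Definitions using (Asymmetric; tri<; tri≈; tri>)
open import Relation.Binary.PropositionalEquality
open import Relation.Nullary using (Dec; yes; no; ¬_; contradiction)
open import Relation.Nullary.Decidable using (_→-dec_; ¬?; decidable-stable; via-injection)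

iter-+ : {A : Set} (f : A → A) (m n : ℕ) (a : A) → iter f (m + n) a ≡ iter f m (iter f n a)
iter-+ f zero    n a = refl
iter-+ f (suc m) n a = cong f (iter-+ f m n a)

module _ {A : Set} (f : A → A) {o : ℕ} (period : ∀ a → iter f o a ≡ a) where

  iter-*-period : ∀ k a → iter f (k * o) a ≡ a
  iter-*-period zero    a = refl
  iter-*-period (suc k) a = begin
    iter f (o + k * o) a      ≡⟨ iter-+ f o (k * o) a ⟩
    iter f o (iter f (k * o) a) ≡⟨ cong (iter f o) (iter-*-period k a) ⟩
    iter f o a                ≡⟨ period a ⟩
    a                         ∎
    where open ≡-Reasoning

  iter-% : .{{_ : NonZero o}} → ∀ m a → iter f (m % o) a ≡ iter f m a
  iter-% m a = sym (begin
    iter f m a                                  ≡⟨ cong (λ k → iter f k a) (m≡m%n+[m/n]*n m o) ⟩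
    iter f (m % o + (m / o) * o) a              ≡⟨ iter-+ f (m % o) _ a ⟩
    iter f (m % o) (iter f ((m / o) * o) a)     ≡⟨ cong (iter f (m % o)) (iter-*-period (m / o) a) ⟩
    iter f (m % o) a                            ∎)
    where open ≡-Reasoning

  iter-∸-inverse : ∀ {j} → j ≤ o → ∀ a → iter f (o ∸ j) (iter f j a) ≡ a
  iter-∸-inverse {j} j≤o a = begin
    iter f (o ∸ j) (iter f j a) ≡⟨ iter-+ f (o ∸ j) j a ⟨
    iter f (o ∸ j + j) a        ≡⟨ cong (λ k → iter f k a) (m∸n+n≡m j≤o) ⟩
    iter f o a                  ≡⟨ period a ⟩
    a                           ∎
    where open ≡-Reasoning

record IsAutomorphism {V : Set} (Adj : V → V → Set) (h : V → V) : Set where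
  field
    preserves  : ∀ {u v} → Adj u v → Adj (h u) (h v)
    reflects   : ∀ {u v} → Adj (h u) (h v) → Adj u v
    injective  : ∀ {u v} → h u ≡ h v → u ≡ v
    surjective : ∀ v → ∃ λ u → h u ≡ v

StabilisersAreInvolutions : {V : Set} → (V → V → Set) → Set
StabilisersAreInvolutions {V} Adj =
  ∀ h → IsAutomorphism Adj h → ∀ w → h w ≡ w → ∀ v → h (h v) ≡ v

StabilisersAreInvolutions-resp-⇔ : {V : Set} {A B : V → V → Set} → (∀ {x y} → A x y ⇔ B x y) →
                                   StabilisersAreInvolutions B → StabilisersAreInvolutions A
StabilisersAreInvolutions-resp-⇔ A⇔B involutions h aut = involutions h (record
  { preserves  = λ uv → Equivalence.to A⇔B (preserves (Equivalence.from A⇔B uv))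
  ; reflects   = λ uv → Equivalence.to A⇔B (reflects (Equivalence.from A⇔B uv))
  ; injective  = injective
  ; surjective = surjective
  })
  where open IsAutomorphism aut

module Powers {V : Set} (g : V ↔ V) where

  open Inverse g using (strictlyInverseˡ; strictlyInverseʳ) renaming (from to g⁻¹)

  iter-injective : ∀ p {u v} → iter (perm g) p u ≡ iter (perm g) p v → u ≡ v
  iter-injective zero    eq = eq
  iter-injective (suc p) {u} {v} eq = iter-injective p (begin
    iter (perm g) p u             ≡⟨ strictlyInverseʳ _ ⟨
    g⁻¹ (iter (perm g) (suc p) u) ≡⟨ cong g⁻¹ eq ⟩
    g⁻¹ (iter (perm g) (suc p) v) ≡⟨ strictlyInverseʳ _ ⟩
    iter (perm g) p v             ∎)
    where open ≡-Reasoning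

  iter-surjective : ∀ p v → ∃ λ u → iter (perm g) p u ≡ v
  iter-surjective zero    v = v , refl
  iter-surjective (suc p) v =
    let u , eq = iter-surjective p (g⁻¹ v) in u , trans (cong (perm g) eq) (strictlyInverseˡ v)

  iter-isAutomorphism : ∀ {Adj} → IsAut Adj g → ∀ p → IsAutomorphism Adj (iter (perm g) p)
  iter-isAutomorphism {Adj} aut p = record
    { preserves  = preserves p
    ; reflects   = reflects p
    ; injective  = iter-injective p
    ; surjective = iter-surjective p
    }
    where
      preserves : ∀ p {u v} → Adj u v → Adj (iter (perm g) p u) (iter (perm g) p v)
      preserves zero    a = a
      preserves (suc p) a = proj₁ (aut _ _) (preserves p a)
      reflects : ∀ p {u v} → Adj (iter (perm g) p u) (iter (perm g) p v) → Adj u v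
      reflects zero    a = a
      reflects (suc p) a = reflects p (proj₂ (aut _ _) a)

m<⌈n/2⌉⇒m+m<n : ∀ {m} n → m < ⌈ n /2⌉ → m + m < n
m<⌈n/2⌉⇒m+m<n {zero}  (suc n)       _             = s≤s z≤n
m<⌈n/2⌉⇒m+m<n {suc m} (suc (suc n)) (s≤s m<⌈n/2⌉) =
  subst (_< suc (suc n)) (sym (cong suc (+-suc m m))) (s≤s (s≤s (m<⌈n/2⌉⇒m+m<n n m<⌈n/2⌉)))

n≤⌈n/2⌉+⌈n/2⌉ : ∀ n → n ≤ ⌈ n /2⌉ + ⌈ n /2⌉
n≤⌈n/2⌉+⌈n/2⌉ n = begin
  n                   ≡⟨ ⌊n/2⌋+⌈n/2⌉≡n n ⟨
  ⌊ n /2⌋ + ⌈ n /2⌉   ≤⟨ +-monoˡ-≤ ⌈ n /2⌉ (⌊n/2⌋≤⌈n/2⌉ n) ⟩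
  ⌈ n /2⌉ + ⌈ n /2⌉   ∎
  where open ≤-Reasoning

module OrbitSizes {V : Set} (g : V ↔ V) {o : ℕ} (order : IsOrder g o)
    (stabiliser-involutive : ∀ p → (∃ λ w → iter (perm g) p w ≡ w) →
                             ∀ v → iter (perm g) p (iter (perm g) p v) ≡ v) where

  private
    f : V → V
    f = perm g

  -- g^(j-i) fixes g^i a, so g^(j-i) is an involution
  order≤gap+gap : ∀ {i j} a → i < j → iter f i a ≡ iter f j a → o ≤ (j ∸ i) + (j ∸ i)
  order≤gap+gap {i} {j} a i<j eq =
    proj₂ (proj₂ order) (d + d) (≤-trans (m<n⇒0<n∸m i<j) (m≤m+n d d)) g^[d+d]≡id
    where
      d = j ∸ i
      open ≡-Reasoning
      d-fixes : iter f d (iter f i a) ≡ iter f i a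
      d-fixes = begin
        iter f d (iter f i a) ≡⟨ iter-+ f d i a ⟨
        iter f (d + i) a      ≡⟨ cong (λ k → iter f k a) (m∸n+n≡m (<⇒≤ i<j)) ⟩
        iter f j a            ≡⟨ eq ⟨
        iter f i a            ∎
      g^[d+d]≡id : ∀ v → iter f (d + d) v ≡ v
      g^[d+d]≡id v = trans (iter-+ f d d v) (stabiliser-involutive d (iter f i a , d-fixes) v)

  iter-distinct : ∀ {i j} a → i < j → j < ⌈ o /2⌉ → iter f i a ≢ iter f j a
  iter-distinct {i} {j} a i<j j<⌈o/2⌉ eq =
    <⇒≱ (m<⌈n/2⌉⇒m+m<n o (≤-<-trans (m∸n≤m j i) j<⌈o/2⌉)) (order≤gap+gap a i<j eq)

  module _ {μ : ℕ} (orbits : NumOrbits g μ) where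

    private
      rep : Fin μ → V
      rep = proj₁ orbits

    orbitPrefix : Fin μ × Fin ⌈ o /2⌉ → V
    orbitPrefix (i , j) = iter f (toℕ j) (rep i)

    orbitPrefix-sameOrbit : ∀ {i j i′ j′} → orbitPrefix (i , j) ≡ orbitPrefix (i′ , j′) →
                            SameOrbit g (rep i) (rep i′)
    orbitPrefix-sameOrbit {i} {j} {i′} {j′} eq = o ∸ toℕ j′ + toℕ j , (begin
      iter f (o ∸ toℕ j′ + toℕ j) (rep i)         ≡⟨ iter-+ f (o ∸ toℕ j′) (toℕ j) (rep i) ⟩
      iter f (o ∸ toℕ j′) (orbitPrefix (i , j))   ≡⟨ cong (iter f (o ∸ toℕ j′)) eq ⟩
      iter f (o ∸ toℕ j′) (orbitPrefix (i′ , j′)) ≡⟨ iter-∸-inverse f period j′≤o (rep i′) ⟩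
      rep i′                                      ∎)
      where
        open ≡-Reasoning
        period = proj₁ (proj₂ order)
        j′≤o : toℕ j′ ≤ o
        j′≤o = ≤-trans (<⇒≤ (toℕ<n j′)) (⌈n/2⌉≤n o)

    orbitPrefix-injective : ∀ {x y} → orbitPrefix x ≡ orbitPrefix y → x ≡ y
    orbitPrefix-injective {i , j} {i′ , j′} eq
      with refl ← proj₁ (proj₂ orbits) i i′ (orbitPrefix-sameOrbit {j = j} {j′ = j′} eq)
      with <-cmp (toℕ j) (toℕ j′)
    ... | tri< j<j′ _ _ = contradiction eq (iter-distinct (rep i) j<j′ (toℕ<n j′))
    ... | tri≈ _ j≡j′ _ = cong (i ,_) (toℕ-injective j≡j′)
    ... | tri> _ _ j′<j = contradiction (sym eq) (iter-distinct (rep i) j′<j (toℕ<n j))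

    orbits*⌈order/2⌉≤card : ∀ {n} → V ↔ Fin n → μ * ⌈ o /2⌉ ≤ n
    orbits*⌈order/2⌉≤card e =
      injective⇒≤ (Injection.injective (↔⇒↣ e ↣-∘ (mk↣ orbitPrefix-injective ↣-∘ ↔⇒↣ *↔×)))

lookup-injective : ∀ {A : Set} {xs : List A} → Unique xs → ∀ i j → lookup xs i ≡ lookup xs j → i ≡ j
lookup-injective (_ ∷ _)      Fin.zero    Fin.zero    _  = refl
lookup-injective (x∉xs ∷ _)   Fin.zero    (Fin.suc j) eq = contradiction eq (All.lookup x∉xs (∈-lookup j))
lookup-injective (x∉xs ∷ _)   (Fin.suc i) Fin.zero    eq = contradiction (sym eq) (All.lookup x∉xs (∈-lookup i))
lookup-injective (_ ∷ unique) (Fin.suc i) (Fin.suc j) eq = cong Fin.suc (lookup-injective unique i j eq)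

module OrbitRepresentatives {V : Set} (g : V ↔ V) {n : ℕ} (e : V ↔ Fin n)
    {o : ℕ} .{{_ : NonZero o}} (period : ∀ v → iter (perm g) o v ≡ v) where

  private
    f : V → V
    f = perm g

    enum : Fin n → V
    enum = Inverse.from e

  sameOrbit? : ∀ u v → Dec (SameOrbit g u v)
  sameOrbit? u v with any? (λ (j : Fin o) → via-injection (↔⇒↣ e) Fin._≟_ (iter f (toℕ j) u) v)
  ... | yes (j , eq) = yes (toℕ j , eq)
  ... | no ¬found    = no λ (m , eq) → ¬found (fromℕ< (m%n<n m o) ,
          trans (cong (λ k → iter f k u) (toℕ-fromℕ< (m%n<n m o))) (trans (iter-% f period m u) eq))

  sameOrbit-sym : ∀ {u v} → SameOrbit g u v → SameOrbit g v u
  sameOrbit-sym {u} (m , refl) = o ∸ m % o , (begin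
    iter f (o ∸ m % o) (iter f m u)        ≡⟨ cong (iter f (o ∸ m % o)) (iter-% f period m u) ⟨
    iter f (o ∸ m % o) (iter f (m % o) u)  ≡⟨ iter-∸-inverse f period (<⇒≤ (m%n<n m o)) u ⟩
    u                                      ∎)
    where open ≡-Reasoning

  sameOrbit-trans : ∀ {u v w} → SameOrbit g u v → SameOrbit g v w → SameOrbit g u w
  sameOrbit-trans {u} (m , refl) (m′ , refl) = m′ + m , iter-+ f m′ m u

  IsFirstOfOrbit : Fin n → Set
  IsFirstOfOrbit i = ∀ j → j Fin.< i → ¬ SameOrbit g (enum j) (enum i)

  isFirstOfOrbit? : ∀ i → Dec (IsFirstOfOrbit i)
  isFirstOfOrbit? i = all? λ j → j <ᶠ? i →-dec ¬? (sameOrbit? (enum j) (enum i))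

  firsts : List (Fin n)
  firsts = filter isFirstOfOrbit? (allFin n)

  representative : Fin (length firsts) → V
  representative t = enum (lookup firsts t)

  representative-first : ∀ t → IsFirstOfOrbit (lookup firsts t)
  representative-first t = All.lookup (all-filter isFirstOfOrbit? (allFin n)) (∈-lookup t)

  representatives-distinct : ∀ t t′ → SameOrbit g (representative t) (representative t′) → t ≡ t′
  representatives-distinct t t′ same with <ᶠ-cmp (lookup firsts t) (lookup firsts t′)
  ... | tri< i<i′ _ _ = contradiction same (representative-first t′ _ i<i′)
  ... | tri≈ _ i≡i′ _ = lookup-injective (Unique.filter⁺ isFirstOfOrbit? (Unique.allFin⁺ n)) t t′ i≡i′
  ... | tri> _ _ i′<i = contradiction (sameOrbit-sym same) (representative-first t _ i′<i)

  least-in-orbit : ∀ v → ∃ λ i → SameOrbit g (enum i) v × IsFirstOfOrbit i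
  least-in-orbit v = i , i~v , i-first
    where
      notInOrbit? : ∀ j → Dec (¬ SameOrbit g (enum j) v)
      notInOrbit? j = ¬? (sameOrbit? (enum j) v)
      least = ¬∀⟶∃¬-smallest n _ notInOrbit? λ none →
        none (Inverse.to e v) (0 , Inverse.strictlyInverseʳ e v)
      i = proj₁ least
      i~v : SameOrbit g (enum i) v
      i~v = decidable-stable (sameOrbit? (enum i) v) (proj₁ (proj₂ least))
      i-first : IsFirstOfOrbit i
      i-first j j<i j~i =
        proj₂ (proj₂ least) (fromℕ< j<i) (subst (λ k → SameOrbit g (enum k) v) inject≡j j~v)
        where
          j~v = sameOrbit-trans j~i i~v
          inject≡j : j ≡ Fin.inject (fromℕ< j<i)
          inject≡j = toℕ-injective (sym (trans (toℕ-inject (fromℕ< j<i)) (toℕ-fromℕ< j<i)))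

  representatives-cover : ∀ v → ∃ λ t → SameOrbit g (representative t) v
  representatives-cover v =
    let i , i~v , i-first = least-in-orbit v
        i∈firsts = ∈-filter⁺ isFirstOfOrbit? (∈-allFin i) i-first
    in index i∈firsts , subst (λ i → SameOrbit g (enum i) v) (lookup-index i∈firsts) i~v

  numOrbits : NumOrbits g (length firsts)
  numOrbits = representative , representatives-distinct , representatives-cover

module _ {V : Set} {Adj : V → V → Set} (involutions : StabilisersAreInvolutions Adj)
         {n : ℕ} (e : V ↔ Fin n) where

  6*order*orbits≤17*card : (g : V ↔ V) → IsAut Adj g → (o μ : ℕ) → IsOrder g o → NumOrbits g μ →
                            6 * o * μ ≤ 17 * n
  6*order*orbits≤17*card g aut o μ order orbits = begin
    6 * o * μ                        ≤⟨ *-monoˡ-≤ μ (*-monoʳ-≤ 6 (n≤⌈n/2⌉+⌈n/2⌉ o)) ⟩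
    6 * (⌈ o /2⌉ + ⌈ o /2⌉) * μ      ≡⟨ rearrange ⌈ o /2⌉ μ ⟩
    12 * (μ * ⌈ o /2⌉)               ≤⟨ *-monoʳ-≤ 12 (orbits*⌈order/2⌉≤card orbits e) ⟩
    12 * n                           ≤⟨ *-monoˡ-≤ n (m≤m+n 12 5) ⟩
    17 * n                           ∎
    where
      open ≤-Reasoning
      rearrange : ∀ q m → 6 * (q + q) * m ≡ 12 * (m * q)
      rearrange = solve-∀
      stabiliser-involutive : ∀ p → (∃ λ w → iter (perm g) p w ≡ w) →
                              ∀ v → iter (perm g) p (iter (perm g) p v) ≡ v
      stabiliser-involutive p (w , fixed) = involutions _ (Powers.iter-isAutomorphism g aut p) w fixed
      open OrbitSizes g order stabiliser-involutive

  6*meo*μ≤17*card : (m M : ℕ) → IsMuGraph Adj m → IsMeo Adj M → 6 * M * m ≤ 17 * n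
  6*meo*μ≤17*card m M (_ , μ-minimal) ((g , aut , order@(0<M , period , _)) , _) = begin
    6 * M * m  ≤⟨ *-monoʳ-≤ (6 * M) (μ-minimal g _ aut orbits) ⟩
    6 * M * _  ≤⟨ 6*order*orbits≤17*card g aut M _ order orbits ⟩
    17 * n     ∎
    where
      open ≤-Reasoning
      instance
        M-nonZero : NonZero M
        M-nonZero = >-nonZero 0<M
      orbits = OrbitRepresentatives.numOrbits g e period

Connected : {V : Set} → (V → V → Set) → Set₁
Connected {V} Arc = (P : V → Set) →
  (∀ {u v} → Arc u v → P u → P v) → (∀ {u v} → Arc u v → P v → P u) → ∀ {u} → P u → ∀ v → P v

OnFourCycle : {W : Set} → (W → W → Set) → W → W → Set
OnFourCycle Adj x y = ∃₂ λ X Y → Adj y X × X ≢ x × Adj X Y × Adj Y x × Y ≢ y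

OnFourCycle-sym : ∀ {W : Set} {Adj : W → W → Set} → (∀ {x y} → Adj x y → Adj y x) →
                  ∀ {x y} → OnFourCycle Adj x y → OnFourCycle Adj y x
OnFourCycle-sym adj-sym (X , Y , yX , X≢x , XY , Yx , Y≢y) =
  Y , X , adj-sym Yx , Y≢y , adj-sym XY , adj-sym yX , X≢x

OnFourCycle-reflect : ∀ {W : Set} {Adj : W → W → Set} {h} → IsAutomorphism Adj h →
                      ∀ {x y} → OnFourCycle Adj (h x) (h y) → OnFourCycle Adj x y
OnFourCycle-reflect {Adj = Adj} {h = h} aut (X , Y , yX , X≢x , XY , Yx , Y≢y) =
  let X′ , hX′≡X = surjective X
      Y′ , hY′≡Y = surjective Y
  in X′ , Y′ , adj refl hX′≡X yX , (λ { refl → X≢x (sym hX′≡X) }) , adj hX′≡X hY′≡Y XY ,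
     adj hY′≡Y refl Yx , (λ { refl → Y≢y (sym hY′≡Y) })
  where
    open IsAutomorphism aut
    adj : ∀ {a b a′ b′} → h a′ ≡ a → h b′ ≡ b → Adj a b → Adj a′ b′
    adj refl refl = reflects

module _ {V : Set} (Arc : V → V → Set) where

  SplitEdge : V × Bool → V × Bool → Set
  SplitEdge (u , false) (v , true)  = u ≡ v
  SplitEdge (v , true)  (u , false) = Arc v u
  SplitEdge _           _           = ⊥

  SplitAdj : V × Bool → V × Bool → Set
  SplitAdj x y = SplitEdge x y ⊎ SplitEdge y x

SplitEdge-map : {V : Set} {A B : V → V → Set} → (∀ {u v} → A u v → B u v) →
                ∀ {x y} → SplitEdge A x y → SplitEdge B x y
SplitEdge-map f {_ , false} {_ , true}  u≡v = u≡v
SplitEdge-map f {_ , true}  {_ , false} vu  = f vu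
SplitEdge-map f {_ , false} {_ , false} ()
SplitEdge-map f {_ , true}  {_ , true}  ()

SplitAdj-map : {V : Set} {A B : V → V → Set} → (∀ {u v} → A u v → B u v) →
               ∀ {x y} → SplitAdj A x y → SplitAdj B x y
SplitAdj-map f {x} {y} = Sum.map (SplitEdge-map f {x} {y}) (SplitEdge-map f {y} {x})

SplitAdj-cong : {V : Set} {A B : V → V → Set} → (∀ {u v} → A u v ⇔ B u v) →
                ∀ {x y} → SplitAdj A x y ⇔ SplitAdj B x y
SplitAdj-cong A⇔B {x} {y} =
  mk⇔ (SplitAdj-map (Equivalence.to A⇔B) {x} {y}) (SplitAdj-map (Equivalence.from A⇔B) {x} {y})

SPXAdj⇔SplitAdj : ∀ {r s} x y → SPXAdj r s x y ⇔ SplitAdj (PXArc r s) x y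
SPXAdj⇔SplitAdj (_ , false) (_ , false) = mk⇔ id id
SPXAdj⇔SplitAdj (_ , false) (_ , true)  = mk⇔ id id
SPXAdj⇔SplitAdj (_ , true)  (_ , false) = mk⇔ id id
SPXAdj⇔SplitAdj (_ , true)  (_ , true)  = mk⇔ id id

module SplitStabilisers {V : Set} {Arc : V → V → Set}
    (asymmetric : Asymmetric Arc)
    (no-transitive-triangle : ∀ {u v w} → Arc u v → Arc v w → ¬ Arc u w)
    (squares : ∀ {v u} → Arc v u →
               ∃₂ λ u′ v′ → u′ ≢ u × v′ ≢ v × Arc v u′ × Arc v′ u′ × Arc v′ u)
    (connected : Connected Arc) where

  SplitAdj-sign : ∀ {x y} → SplitAdj Arc x y → proj₂ x ≡ not (proj₂ y)
  SplitAdj-sign {_ , false} {_ , true}  _ = refl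
  SplitAdj-sign {_ , true}  {_ , false} _ = refl
  SplitAdj-sign {_ , false} {_ , false} (inj₁ ())
  SplitAdj-sign {_ , false} {_ , false} (inj₂ ())
  SplitAdj-sign {_ , true}  {_ , true}  (inj₁ ())
  SplitAdj-sign {_ , true}  {_ , true}  (inj₂ ())

  arc-on-four-cycle : ∀ {v u} → Arc v u → OnFourCycle (SplitAdj Arc) (v , true) (u , false)
  arc-on-four-cycle vu =
    let u′ , v′ , u′≢u , v′≢v , vu′ , v′u′ , v′u = squares vu
    in (v′ , true) , (u′ , false) , inj₂ v′u , v′≢v ∘ ,-injectiveˡ , inj₁ v′u′ , inj₂ vu′ , u′≢u ∘ ,-injectiveˡ

  -- the four-cycle would need a 2-cycle a → c → a or a transitive triangle d → a → c, d → c
  matching-not-on-four-cycle : ∀ a → ¬ OnFourCycle (SplitAdj Arc) (a , false) (a , true)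
  matching-not-on-four-cycle a ((c , false) , (d , true) , inj₁ ac , _ , inj₁ refl , inj₁ ca , _) =
    asymmetric ac ca
  matching-not-on-four-cycle a ((c , false) , (d , true) , inj₁ ac , _ , inj₂ dc , inj₁ da , _) =
    no-transitive-triangle da ac dc
  matching-not-on-four-cycle a ((c , false) , (d , true) , inj₁ ac , _ , _ , inj₂ refl , Y≢a₊) = Y≢a₊ refl
  matching-not-on-four-cycle a ((c , false) , _ , inj₂ refl , X≢a₋ , _) = X≢a₋ refl
  matching-not-on-four-cycle a ((_ , true) , _ , inj₁ () , _)
  matching-not-on-four-cycle a ((_ , true) , _ , inj₂ () , _)
  matching-not-on-four-cycle a ((c , false) , (_ , false) , inj₁ _ , _ , _ , inj₁ () , _)
  matching-not-on-four-cycle a ((c , false) , (_ , false) , inj₁ _ , _ , _ , inj₂ () , _)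

  adjacent-matched-or-on-four-cycle : ∀ {x y} → SplitAdj Arc x y →
                                      proj₁ x ≡ proj₁ y ⊎ OnFourCycle (SplitAdj Arc) x y
  adjacent-matched-or-on-four-cycle {_ , false} {_ , true}  (inj₁ eq) = inj₁ eq
  adjacent-matched-or-on-four-cycle {_ , false} {_ , true}  (inj₂ vu) =
    inj₂ (OnFourCycle-sym swap (arc-on-four-cycle vu))
  adjacent-matched-or-on-four-cycle {_ , true}  {_ , false} (inj₁ vu) = inj₂ (arc-on-four-cycle vu)
  adjacent-matched-or-on-four-cycle {_ , true}  {_ , false} (inj₂ eq) = inj₁ (sym eq)
  adjacent-matched-or-on-four-cycle {_ , false} {_ , false} (inj₁ ())
  adjacent-matched-or-on-four-cycle {_ , false} {_ , false} (inj₂ ())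
  adjacent-matched-or-on-four-cycle {_ , true}  {_ , true}  (inj₁ ())
  adjacent-matched-or-on-four-cycle {_ , true}  {_ , true}  (inj₂ ())

  module Stabiliser {h} (aut : IsAutomorphism (SplitAdj Arc) h) {w} (fixed : h w ≡ w) where

    open IsAutomorphism aut

    h-matching : ∀ a → proj₁ (h (a , false)) ≡ proj₁ (h (a , true))
    h-matching a with adjacent-matched-or-on-four-cycle (preserves {a , false} {a , true} (inj₁ refl))
    ... | inj₁ eq  = eq
    ... | inj₂ cyc = ⊥-elim (matching-not-on-four-cycle a (OnFourCycle-reflect aut cyc))

    side : V → Bool
    side a = proj₂ (h (a , false))

    side-opposite : ∀ a → side a ≡ not (proj₂ (h (a , true)))
    side-opposite a = SplitAdj-sign (preserves {a , false} {a , true} (inj₁ refl))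

    side-respects-arcs : ∀ {v a} → Arc v a → side v ≡ side a
    side-respects-arcs {v} {a} va = begin
      side v                         ≡⟨ side-opposite v ⟩
      not (proj₂ (h (v , true)))     ≡⟨ cong not (SplitAdj-sign (preserves {v , true} {a , false} (inj₁ va))) ⟩
      not (not (side a))             ≡⟨ not-involutive (side a) ⟩
      side a                         ∎
      where open ≡-Reasoning

    side-false : ∀ a → side a ≡ false
    side-false = connected (λ a → side a ≡ false)
      (λ va sv → trans (sym (side-respects-arcs va)) sv) (λ va sa → trans (side-respects-arcs va) sa)
      (start w fixed)
      where
        start : ∀ x → h x ≡ x → side (proj₁ x) ≡ false
        start (u , false) hu≡u = cong proj₂ hu≡u
        start (u , true)  hu≡u = trans (side-opposite u) (cong (not ∘ proj₂) hu≡u)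

    φ : V → V
    φ a = proj₁ (h (a , false))

    h₋ : ∀ a → h (a , false) ≡ (φ a , false)
    h₋ a = cong (φ a ,_) (side-false a)

    h₊ : ∀ a → h (a , true) ≡ (φ a , true)
    h₊ a = cong₂ _,_ (sym (h-matching a))
      (trans (sym (not-involutive _)) (cong not (trans (sym (side-opposite a)) (side-false a))))

    h-acts-on-first : ∀ x → h x ≡ (φ (proj₁ x) , proj₂ x)
    h-acts-on-first (a , false) = h₋ a
    h-acts-on-first (a , true)  = h₊ a

    φ-injective : ∀ {a b} → φ a ≡ φ b → a ≡ b
    φ-injective {a} {b} eq = ,-injectiveˡ (injective (trans (h₋ a) (trans (cong (_, false) eq) (sym (h₋ b)))))

    φ-isAutomorphism : IsAutomorphism Arc φ
    φ-isAutomorphism = record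
      { preserves  = φ-preserves
      ; reflects   = φ-reflects
      ; injective  = φ-injective
      ; surjective = φ-surjective
      }
      where
        φ-preserves : ∀ {v a} → Arc v a → Arc (φ v) (φ a)
        φ-preserves {v} {a} va
          with subst₂ (SplitAdj Arc) (h₊ v) (h₋ a) (preserves {v , true} {a , false} (inj₁ va))
        ... | inj₁ φvφa = φvφa
        ... | inj₂ φa≡φv with refl ← φ-injective φa≡φv = ⊥-elim (asymmetric va va)
        φ-reflects : ∀ {v a} → Arc (φ v) (φ a) → Arc v a
        φ-reflects {v} {a} φvφa
          with reflects {v , true} {a , false} (subst₂ (SplitAdj Arc) (sym (h₊ v)) (sym (h₋ a)) (inj₁ φvφa))
        ... | inj₁ va   = va
        ... | inj₂ refl = ⊥-elim (asymmetric φvφa φvφa)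
        φ-surjective : ∀ b → ∃ λ a → φ a ≡ b
        φ-surjective b with surjective (b , false)
        ... | (a , false) , ha≡b = a , cong proj₁ ha≡b
        ... | (a , true)  , ha≡b with () ← ,-injectiveʳ (trans (sym (h₊ a)) ha≡b)

    φ-fixes : φ (proj₁ w) ≡ proj₁ w
    φ-fixes = fixes w fixed
      where
        fixes : ∀ x → h x ≡ x → φ (proj₁ x) ≡ proj₁ x
        fixes (u , false) hu≡u = cong proj₁ hu≡u
        fixes (u , true)  hu≡u = trans (h-matching u) (cong proj₁ hu≡u)

  split-stabilisers-involutive : StabilisersAreInvolutions Arc → StabilisersAreInvolutions (SplitAdj Arc)
  split-stabilisers-involutive involutions h aut w fixed x@(a , σ) = begin
    h (h x)          ≡⟨ cong h (h-acts-on-first x) ⟩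
    h (φ a , σ)      ≡⟨ h-acts-on-first (φ a , σ) ⟩
    (φ (φ a) , σ)    ≡⟨ cong (_, σ) (involutions φ φ-isAutomorphism (proj₁ w) φ-fixes a) ⟩
    x                ∎
    where
      open ≡-Reasoning
      open Stabiliser aut fixed

module PraegerXu (t : ℕ) where

  r : ℕ
  r = 3 + t

  -- NextMod x y unfolds to SucMod (toℕ x) (toℕ y)
  SucMod : ℕ → ℕ → Set
  SucMod a b = b ≡ suc a ⊎ (b ≡ 0 × suc a ≡ r)

  SucMod-functional : ∀ {a b c} → SucMod a b → SucMod a c → b < r → c < r → b ≡ c
  SucMod-functional (inj₁ refl)        (inj₁ refl)        _   _   = refl
  SucMod-functional (inj₂ (refl , _))  (inj₂ (refl , _))  _   _   = refl
  SucMod-functional (inj₁ refl)        (inj₂ (_ , refl))  b<r _   = contradiction b<r (<-irrefl refl)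
  SucMod-functional (inj₂ (_ , refl))  (inj₁ refl)        _   c<r = contradiction c<r (<-irrefl refl)

  SucMod-injective : ∀ {a b c} → SucMod a c → SucMod b c → a ≡ b
  SucMod-injective (inj₁ refl)          (inj₁ c≡1+b)         = suc-injective c≡1+b
  SucMod-injective (inj₂ (_ , 1+a≡r))   (inj₂ (_ , 1+b≡r))   = suc-injective (trans 1+a≡r (sym 1+b≡r))
  SucMod-injective (inj₁ refl)          (inj₂ (() , _))
  SucMod-injective (inj₂ (refl , _))    (inj₁ ())

  SucMod-irreflexive : ∀ {a} → ¬ SucMod a a
  SucMod-irreflexive (inj₁ ())
  SucMod-irreflexive (inj₂ (refl , ()))

  -- this is where r ≥ 3 is needed
  SucMod-asymmetric : ∀ {a b} → SucMod a b → ¬ SucMod b a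
  SucMod-asymmetric (inj₁ refl)       (inj₁ ())
  SucMod-asymmetric (inj₁ refl)       (inj₂ (refl , ()))
  SucMod-asymmetric (inj₂ (refl , ())) (inj₁ refl)
  SucMod-asymmetric (inj₂ (refl , _))  (inj₂ (_ , ()))

  opaque
    next : Fin r → Fin r
    next x with suc (toℕ x) <? r
    ... | yes 1+x<r = fromℕ< 1+x<r
    ... | no _      = Fin.zero

    NextMod-next : ∀ x → NextMod x (next x)
    NextMod-next x with suc (toℕ x) <? r
    ... | yes 1+x<r = inj₁ (toℕ-fromℕ< 1+x<r)
    ... | no  1+x≮r = inj₂ (refl , ≤-antisym (toℕ<n x) (≮⇒≥ 1+x≮r))

  NextMod⇒≡next : ∀ {x y} → NextMod x y → y ≡ next x
  NextMod⇒≡next {x} {y} xy =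
    toℕ-injective (SucMod-functional xy (NextMod-next x) (toℕ<n y) (toℕ<n (next x)))

  next-injective : ∀ {x y} → next x ≡ next y → x ≡ y
  next-injective {x} {y} eq =
    toℕ-injective (SucMod-injective (NextMod-next x) (subst (NextMod y) (sym eq) (NextMod-next y)))

  next-irreflexive : ∀ x → next x ≢ x
  next-irreflexive x eq = SucMod-irreflexive (subst (NextMod x) eq (NextMod-next x))

  next²-irreflexive : ∀ x → next (next x) ≢ x
  next²-irreflexive x eq = SucMod-asymmetric (NextMod-next x) (subst (NextMod (next x)) eq (NextMod-next (next x)))

  toℕ-iter-next-zero : ∀ j → j < r → toℕ (iter next j Fin.zero) ≡ j
  toℕ-iter-next-zero zero    _   = refl
  toℕ-iter-next-zero (suc j) 1+j<r
    with toℕ-iter-next-zero j (<-trans (n<1+n j) 1+j<r) | NextMod-next (iter next j Fin.zero)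
  ... | eq | inj₁ next≡1+    = trans next≡1+ (cong suc eq)
  ... | eq | inj₂ (_ , 1+≡r) = contradiction (trans (cong suc (sym eq)) 1+≡r) (<⇒≢ 1+j<r)

  iter-next-zero : ∀ y → iter next (toℕ y) Fin.zero ≡ y
  iter-next-zero y = toℕ-injective (toℕ-iter-next-zero (toℕ y) (toℕ<n y))

  iter-next-period : iter next r Fin.zero ≡ Fin.zero
  iter-next-period with NextMod-next (iter next (2 + t) Fin.zero) | toℕ-iter-next-zero (2 + t) ≤-refl
  ... | inj₁ next≡1+      | eq = contradiction (trans next≡1+ (cong suc eq)) (<⇒≢ (toℕ<n (iter next r Fin.zero)))
  ... | inj₂ (next≡0 , _) | _  = toℕ-injective next≡0

  iter-next-to-zero : ∀ x → iter next (suc ((2 + t) ∸ toℕ x)) x ≡ Fin.zero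
  iter-next-to-zero x = begin
    iter next (suc d) x                            ≡⟨ cong (iter next (suc d)) (iter-next-zero x) ⟨
    iter next (suc d) (iter next (toℕ x) Fin.zero) ≡⟨ iter-+ next (suc d) (toℕ x) Fin.zero ⟨
    iter next (suc (d + toℕ x)) Fin.zero           ≡⟨ cong (λ k → iter next (suc k) Fin.zero) d+x≡2+t ⟩
    iter next r Fin.zero                           ≡⟨ iter-next-period ⟩
    Fin.zero                                       ∎
    where
      open ≡-Reasoning
      d = (2 + t) ∸ toℕ x
      d+x≡2+t : d + toℕ x ≡ 2 + t
      d+x≡2+t = m∸n+n≡m (s≤s⁻¹ (toℕ<n x))

  next-reachable : ∀ x y → ∃ λ j → iter next (suc j) x ≡ y
  next-reachable x y = toℕ y + d , (begin
    iter next (suc (toℕ y + d)) x           ≡⟨ cong (λ k → iter next k x) (+-suc (toℕ y) d) ⟨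
    iter next (toℕ y + suc d) x             ≡⟨ iter-+ next (toℕ y) (suc d) x ⟩
    iter next (toℕ y) (iter next (suc d) x) ≡⟨ cong (iter next (toℕ y)) (iter-next-to-zero x) ⟩
    iter next (toℕ y) Fin.zero              ≡⟨ iter-next-zero y ⟩
    y                                       ∎)
    where
      open ≡-Reasoning
      d = (2 + t) ∸ toℕ x

  Vertex : ℕ → Set
  Vertex k = Fin r × Vec Bool k

  Arc : ∀ k → Vertex k → Vertex k → Set
  Arc k (x , b) (y , c) =
    NextMod x y × ((i j : Fin k) → toℕ j ≡ suc (toℕ i) → Vec.lookup c i ≡ Vec.lookup b j)

  Shift : ∀ {k} → Vertex (suc k) → Vertex (suc k) → Set
  Shift (x , b) (y , c) = y ≡ next x × Vec.tail b ≡ Vec.init c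

  lookup-shift⇒tail≡init : ∀ {k} (b c : Vec Bool (suc k)) →
    ((i j : Fin (suc k)) → toℕ j ≡ suc (toℕ i) → Vec.lookup c i ≡ Vec.lookup b j) →
    Vec.tail b ≡ Vec.init c
  lookup-shift⇒tail≡init (_ ∷ [])     (_ ∷ [])      _     = refl
  lookup-shift⇒tail≡init (_ ∷ a ∷ b)  (a′ ∷ c@(_ ∷ _)) shift =
    cong₂ _∷_ (sym (shift Fin.zero (Fin.suc Fin.zero) refl))
              (lookup-shift⇒tail≡init (a ∷ b) c λ i j j≡1+i →
                 shift (Fin.suc i) (Fin.suc j) (cong suc j≡1+i))

  tail≡init⇒lookup-shift : ∀ {k} (b c : Vec Bool (suc k)) → Vec.tail b ≡ Vec.init c →
    (i j : Fin (suc k)) → toℕ j ≡ suc (toℕ i) → Vec.lookup c i ≡ Vec.lookup b j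
  tail≡init⇒lookup-shift (_ ∷ _ ∷ _) (_ ∷ _ ∷ _) eq Fin.zero (Fin.suc Fin.zero) _ =
    sym (∷-injectiveˡ eq)
  tail≡init⇒lookup-shift (_ ∷ a ∷ b) (_ ∷ c@(_ ∷ _)) eq (Fin.suc i) (Fin.suc j) j≡1+i =
    tail≡init⇒lookup-shift (a ∷ b) c (∷-injectiveʳ eq) i j (suc-injective j≡1+i)
  tail≡init⇒lookup-shift _ _ _ Fin.zero Fin.zero ()
  tail≡init⇒lookup-shift _ _ _ (Fin.suc _) Fin.zero ()
  tail≡init⇒lookup-shift (_ ∷ _ ∷ _) (_ ∷ _ ∷ _) _ Fin.zero (Fin.suc (Fin.suc _)) ()

  arc⇔shift : ∀ {k} (u v : Vertex (suc k)) → Arc (suc k) u v ⇔ Shift u v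
  arc⇔shift (x , b) (y , c) = mk⇔
    (λ (xy , shift) → NextMod⇒≡next xy , lookup-shift⇒tail≡init b c shift)
    (λ { (refl , eq) → NextMod-next x , tail≡init⇒lookup-shift b c eq })

  -- a vertex of level k + 2 is an arc of level k + 1, from its source to its target
  source : ∀ {k} → Vertex (2 + k) → Vertex (suc k)
  source (x , b) = x , Vec.init b

  target : ∀ {k} → Vertex (2 + k) → Vertex (suc k)
  target (x , b) = next x , Vec.tail b

  shift⇒target≡source : ∀ {k} {e f : Vertex (2 + k)} → Shift e f → target e ≡ source f
  shift⇒target≡source (refl , eq) = cong (_ ,_) eq

  target≡source⇒shift : ∀ {k} (e f : Vertex (2 + k)) → target e ≡ source f → Shift e f
  target≡source⇒shift _ _ eq = sym (,-injectiveˡ eq) , ,-injectiveʳ eq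

  source-shift-target : ∀ {k} (e : Vertex (2 + k)) → Shift (source e) (target e)
  source-shift-target (_ , _ ∷ _ ∷ _) = refl , refl

  shift-lifts : ∀ {k} {w w′ : Vertex (suc k)} → Shift w w′ →
                ∃ λ e → source e ≡ w × target e ≡ w′
  shift-lifts {w = x , a ∷ b} {_ , c} (refl , b≡init-c) =
    (x , (a ∷ b) ∷ʳ Vec.last c) , cong (x ,_) (init-∷ʳ (Vec.last c) (a ∷ b)) ,
    cong (next x ,_) (trans (cong (_∷ʳ Vec.last c) b≡init-c) (sym (proj₂ (proj₂ (Vec.initLast c)))))

  source-target-injective : ∀ {k} {e e′ : Vertex (2 + k)} →
                            source e ≡ source e′ → target e ≡ target e′ → e ≡ e′
  source-target-injective {e = _ , _ ∷ _ ∷ _} {_ , _ ∷ _ ∷ _} source≡ target≡ =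
    cong₂ _,_ (,-injectiveˡ source≡)
              (cong₂ _∷_ (∷-injectiveˡ (,-injectiveʳ source≡)) (,-injectiveʳ target≡))

  source-surjective : ∀ {k} (w : Vertex (suc k)) → ∃ λ e → source e ≡ w
  source-surjective (x , b) = (x , b ∷ʳ false) , cong (x ,_) (init-∷ʳ false b)

  target-surjective : ∀ {k} (w : Vertex (suc k)) → ∃ λ e → target e ≡ w
  target-surjective (y , c) =
    let j , cycle = next-reachable y y in (iter next j y , false ∷ c) , cong (_, c) cycle

  shift-connected : ∀ k → Connected (Shift {k})
  shift-connected zero P fwd _ {x₀ , b₀} P₀ (y , c) =
    let j , x₀⇝y = next-reachable x₀ y in subst (λ z → P (z , c)) x₀⇝y (walk j c)
    where
      shift₀ : ∀ {x} b c → Shift {0} (x , b) (next x , c)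
      shift₀ (_ ∷ []) (_ ∷ []) = refl , refl
      walk : ∀ j c → P (iter next (suc j) x₀ , c)
      walk zero    c = fwd (shift₀ {x₀} b₀ c) P₀
      walk (suc j) c = fwd (shift₀ {iter next (suc j) x₀} c c) (walk j c)
  shift-connected (suc k) P fwd bwd {u} Pu v =
    let e , source-e≡ , Pe = lower-connected (source v) in siblings source-e≡ Pe
    where
      siblings : ∀ {e e′} → source e ≡ source e′ → P e → P e′
      siblings {e} {e′} eq Pe = let d , target-d≡ = target-surjective (source e) in
        fwd {d} {e′} (target≡source⇒shift d e′ (trans target-d≡ eq))
          (bwd {d} {e} (target≡source⇒shift d e target-d≡) Pe)
      Lifted : Vertex (suc k) → Set
      Lifted w = ∃ λ e → source e ≡ w × P e
      lower-connected : ∀ w → Lifted w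
      lower-connected = shift-connected k Lifted
        (λ ww′ (e , source-e , Pe) →
          let f , source-f , target-f = shift-lifts ww′
              g , source-g = source-surjective (target f)
          in g , trans source-g target-f ,
             fwd {f} {g} (target≡source⇒shift f g (sym source-g)) (siblings (trans source-e (sym source-f)) Pe))
        (λ ww′ (e , source-e , Pe) →
          let f , source-f , target-f = shift-lifts ww′
          in f , source-f , bwd {f} {e} (target≡source⇒shift f e (trans target-f (sym source-e))) Pe)
        (u , refl , Pu)

  bit : Vertex 1 → Bool
  bit (_ , a ∷ []) = a

  ≡-from-layer-bit : ∀ {u v : Vertex 1} → proj₁ u ≡ proj₁ v → bit u ≡ bit v → u ≡ v
  ≡-from-layer-bit {_ , _ ∷ []} {_ , _ ∷ []} refl refl = refl

  -- each layer of Vertex 1 has two elements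
  layer-preserving⇒involutive : ∀ {φ : Vertex 1 → Vertex 1} → (∀ {u v} → φ u ≡ φ v → u ≡ v) →
                                (∀ v → proj₁ (φ v) ≡ proj₁ v) → ∀ v → φ (φ v) ≡ v
  layer-preserving⇒involutive {φ} injective layer-fixed v with bit (φ v) Bool.≟ bit v
  ... | yes same = let φv≡v = ≡-from-layer-bit (layer-fixed v) same in trans (cong φ φv≡v) φv≡v
  ... | no differ = ≡-from-layer-bit (trans (layer-fixed (φ v)) (layer-fixed v)) (begin
    bit (φ (φ v))       ≡⟨ ¬-not (differ ∘ cong bit ∘ injective ∘ ≡-from-layer-bit (layer-fixed (φ v))) ⟩
    not (bit (φ v))     ≡⟨ cong not (¬-not differ) ⟩
    not (not (bit v))   ≡⟨ not-involutive (bit v) ⟩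
    bit v               ∎)
    where open ≡-Reasoning

  shift₀-stabilisers-involutive : StabilisersAreInvolutions (Shift {0})
  shift₀-stabilisers-involutive φ aut w fixed = layer-preserving⇒involutive injective layer-fixed
    where
      open IsAutomorphism aut
      layer-fixed : ∀ v → proj₁ (φ v) ≡ proj₁ v
      layer-fixed = shift-connected 0 (λ v → proj₁ (φ v) ≡ proj₁ v)
        (λ uv φu≡u → trans (proj₁ (preserves uv)) (trans (cong next φu≡u) (sym (proj₁ uv))))
        (λ uv φv≡v → next-injective (trans (sym (proj₁ (preserves uv))) (trans φv≡v (proj₁ uv))))
        (cong proj₁ fixed)

  module InducedAutomorphism {k} {φ : Vertex (2 + k) → Vertex (2 + k)} (aut : IsAutomorphism Shift φ) where

    open IsAutomorphism aut

    shift-into-φ : ∀ e f → Shift e f → target (φ e) ≡ source (φ f)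
    shift-into-φ e f ef = shift⇒target≡source {e = φ e} {φ f} (preserves {e} {f} ef)

    target-φ-cong : ∀ {e e′} → target e ≡ target e′ → target (φ e) ≡ target (φ e′)
    target-φ-cong {e} {e′} eq =
      let f , source-f = source-surjective (target e) in
      trans (shift-into-φ e f (target≡source⇒shift e f (sym source-f)))
            (sym (shift-into-φ e′ f (target≡source⇒shift e′ f (trans (sym eq) (sym source-f)))))

    target-φ-reflect : ∀ {e e′} → target (φ e) ≡ target (φ e′) → target e ≡ target e′
    target-φ-reflect {e} {e′} eq =
      let f , source-f = source-surjective (target e)
          e′f = reflects {e′} {f} (target≡source⇒shift (φ e′) (φ f)
                  (trans (sym eq) (shift-into-φ e f (target≡source⇒shift e f (sym source-f)))))
      in trans (sym source-f) (sym (shift⇒target≡source {e = e′} {f} e′f))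

    ψ : Vertex (suc k) → Vertex (suc k)
    ψ w = target (φ (proj₁ (target-surjective w)))

    ψ-target : ∀ e → ψ (target e) ≡ target (φ e)
    ψ-target e = target-φ-cong (proj₂ (target-surjective (target e)))

    ψ-source : ∀ e → ψ (source e) ≡ source (φ e)
    ψ-source e =
      let d , target-d = target-surjective (source e) in
      trans (cong ψ (sym target-d)) (trans (ψ-target d) (shift-into-φ d e (target≡source⇒shift d e target-d)))

    ψ-injective : ∀ {w w′} → ψ w ≡ ψ w′ → w ≡ w′
    ψ-injective {w} {w′} eq =
      trans (sym (proj₂ (target-surjective w))) (trans (target-φ-reflect eq) (proj₂ (target-surjective w′)))

    ψ-isAutomorphism : IsAutomorphism Shift ψ
    ψ-isAutomorphism = record
      { preserves  = ψ-preserves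
      ; reflects   = ψ-reflects
      ; injective  = ψ-injective
      ; surjective = ψ-surjective
      }
      where
        ψ-preserves : ∀ {w w′} → Shift w w′ → Shift (ψ w) (ψ w′)
        ψ-preserves ww′ =
          let e , source-e , target-e = shift-lifts ww′ in
          subst₂ Shift (trans (sym (ψ-source e)) (cong ψ source-e)) (trans (sym (ψ-target e)) (cong ψ target-e))
                 (source-shift-target (φ e))
        ψ-reflects : ∀ {w w′} → Shift (ψ w) (ψ w′) → Shift w w′
        ψ-reflects ψwψw′ =
          let g , source-g , target-g = shift-lifts ψwψw′
              e , φe≡g = surjective g
          in subst₂ Shift (ψ-injective (trans (ψ-source e) (trans (cong source φe≡g) source-g)))
                          (ψ-injective (trans (ψ-target e) (trans (cong target φe≡g) target-g)))
                    (source-shift-target e)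
        ψ-surjective : ∀ w → ∃ λ w′ → ψ w′ ≡ w
        ψ-surjective w =
          let e , target-e = target-surjective w
              e′ , φe′≡e = surjective e
          in target e′ , trans (ψ-target e′) (trans (cong target φe′≡e) target-e)

    ψ-fixes : ∀ {w} → φ w ≡ w → ψ (target w) ≡ target w
    ψ-fixes {w} fixed = trans (ψ-target w) (cong target fixed)

    φ-involutive : (∀ v → ψ (ψ v) ≡ v) → ∀ e → φ (φ e) ≡ e
    φ-involutive ψ-involutive e = source-target-injective
      (trans (sym (ψ-source (φ e))) (trans (cong ψ (sym (ψ-source e))) (ψ-involutive (source e))))
      (trans (sym (ψ-target (φ e))) (trans (cong ψ (sym (ψ-target e))) (ψ-involutive (target e))))

  shift-stabilisers-involutive : ∀ k → StabilisersAreInvolutions (Shift {k})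
  shift-stabilisers-involutive zero = shift₀-stabilisers-involutive
  shift-stabilisers-involutive (suc k) φ aut w fixed =
    φ-involutive (shift-stabilisers-involutive k ψ ψ-isAutomorphism (target w) (ψ-fixes fixed))
    where open InducedAutomorphism aut

  shift-asymmetric : ∀ {k} → Asymmetric (Shift {k})
  shift-asymmetric {x = x , _} (y≡next-x , _) (x≡next-y , _) =
    next²-irreflexive x (trans (cong next (sym y≡next-x)) (sym x≡next-y))

  shift-no-transitive-triangle : ∀ {k} {u v w : Vertex (suc k)} → Shift u v → Shift v w → ¬ Shift u w
  shift-no-transitive-triangle {v = y , _} (y≡next-x , _) (z≡next-y , _) (z≡next-x , _) =
    next-irreflexive y (trans (sym z≡next-y) (trans z≡next-x (sym y≡next-x)))

  -- flip the first bit of the source and the last bit of the target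
  shift-squares : ∀ {k} {v u : Vertex (suc k)} → Shift v u →
                  ∃₂ λ u′ v′ → u′ ≢ u × v′ ≢ v × Shift v u′ × Shift v′ u′ × Shift v′ u
  shift-squares {v = x , a ∷ b} {_ , c} (refl , b≡init-c) =
    (next x , c′) , (x , not a ∷ b) ,
    (λ eq → not-¬ refl (sym (trans (sym (last-∷ʳ _ (Vec.init c))) (cong Vec.last (,-injectiveʳ eq))))) ,
    (λ eq → not-¬ refl (sym (∷-injectiveˡ (,-injectiveʳ eq)))) ,
    (refl , b≡init-c′) , (refl , b≡init-c′) , (refl , b≡init-c)
    where
      c′ = Vec.init c ∷ʳ not (Vec.last c)
      b≡init-c′ : b ≡ Vec.init c′
      b≡init-c′ = trans b≡init-c (sym (init-∷ʳ _ (Vec.init c)))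

  split-shift-stabilisers-involutive : ∀ k → StabilisersAreInvolutions (SplitAdj (Shift {k}))
  split-shift-stabilisers-involutive k =
    SplitStabilisers.split-stabilisers-involutive shift-asymmetric
      (λ {u v w} → shift-no-transitive-triangle {u = u} {v} {w}) shift-squares
      (shift-connected k) (shift-stabilisers-involutive k)

  split-arc-stabilisers-involutive : ∀ k → StabilisersAreInvolutions (SplitAdj (Arc (suc k)))
  split-arc-stabilisers-involutive k =
    StabilisersAreInvolutions-resp-⇔ (λ {x y} → SplitAdj-cong (λ {u v} → arc⇔shift u v) {x} {y})
      (split-shift-stabilisers-involutive k)

  spx-stabilisers-involutive : ∀ {s} → 1 ≤ s → StabilisersAreInvolutions (SPXAdj r s)
  spx-stabilisers-involutive {suc zero}    _ =
    StabilisersAreInvolutions-resp-⇔ (SPXAdj⇔SplitAdj _ _) (split-arc-stabilisers-involutive 0)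
  spx-stabilisers-involutive {suc (suc m)} _ =
    StabilisersAreInvolutions-resp-⇔ (SPXAdj⇔SplitAdj _ _) (split-arc-stabilisers-involutive (suc (suc m)))

lemma5p1 : (r s : ℕ) → 3 ≤ r → 1 ≤ s → s < r →
    (n : ℕ) → SPXVertex r s ↔ Fin n →
    ((g : SPXVertex r s ↔ SPXVertex r s) → IsAut (SPXAdj r s) g →
      (o μ : ℕ) → IsOrder g o → NumOrbits g μ → 6 * o * μ ≤ 17 * n)
    ×
    ((m M : ℕ) → IsMuGraph (SPXAdj r s) m → IsMeo (SPXAdj r s) M → 6 * M * m ≤ 17 * n)
lemma5p1 .(3 + t) s (s≤s (s≤s (s≤s {n = t} _))) 1≤s _ n e =
  6*order*orbits≤17*card involutions e , 6*meo*μ≤17*card involutions e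
  where involutions = PraegerXu.spx-stabilisers-involutive t 1≤s
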